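{- Let $A$ be a $p$-semisimple pseudo-BCI algebra. Then a map $d:A\to A$ is a type II symmetric derivation on $A$ if and only if it is a type II implicative derivation on $A$.
   Context: A pseudo-BCI algebra is a structure $(A,\to,\rightsquigarrow,1)$ of type $(2,2,0)$ such that for all $x,y,z\in A$: $(x\to y)\rightsquigarrow[(y\to z)\rightsquigarrow(x\to z)]=1$; $(x\rightsquigarrow y)\to[(y\rightsquigarrow z)\to(x\rightsquigarrow z)]=1$; $1\to x=x$; $1\rightsquigarrow x=x$; and $x\to y=1$, $y\to x=1$ imply $x=y$. Write $x\le y$ iff $x\to y=1$. $A$ is $p$-semisimple if $x\le 1$ implies $x=1$. Put $x\Cup_1 y=(x\to y)\rightsquigarrow y$ and $x\Cup_2 y=(x\rightsquigarrow y)\to y$. A map $d:A\to A$ is a type II implicative derivation if $d(x\to y)=(d(x)\to y)\Cup_2(x\to d(y))$ and $d(x\rightsquigarrow y)=(d(x)\rightsquigarrow y)\Cup_1(x\rightsquigarrow d(y))$ for all $x,y$; it is a type II symmetric derivation if $d(x\to y)=(d(x)\to y)\Cup_2(d(y)\to x)$ and $d(x\rightsquigarrow y)=(d(x)\rightsquigarrow y)\Cup_1(d(y)\rightsquigarrow x)$ for all $x,y$. -}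

module Defs where

open import Level using (Level; suc)
open import Relation.Binary.PropositionalEquality using (_≡_)
open import Data.Product using (_×_)

record PseudoBCI (a : Level) : Set (suc a) where
  infixr 5 _⇒_ _⇝_
  field
    Carrier : Set a
    _⇒_ : Carrier → Carrier → Carrier
    _⇝_ : Carrier → Carrier → Carrier
    𝟏   : Carrier
    ax1 : ∀ x y z → (x ⇒ y) ⇝ ((y ⇒ z) ⇝ (x ⇒ z)) ≡ 𝟏
    ax2 : ∀ x y z → (x ⇝ y) ⇒ ((y ⇝ z) ⇒ (x ⇝ z)) ≡ 𝟏
    ax3 : ∀ x → 𝟏 ⇒ x ≡ x
    ax4 : ∀ x → 𝟏 ⇝ x ≡ x
    ax5 : ∀ x y → x ⇒ y ≡ 𝟏 → y ⇒ x ≡ 𝟏 → x ≡ y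

  _≤_ : Carrier → Carrier → Set a
  x ≤ y = x ⇒ y ≡ 𝟏

  _⋓₁_ : Carrier → Carrier → Carrier
  x ⋓₁ y = (x ⇒ y) ⇝ y

  _⋓₂_ : Carrier → Carrier → Carrier
  x ⋓₂ y = (x ⇝ y) ⇒ y

module _ {a : Level} (A : PseudoBCI a) where
  open PseudoBCI A

  IsPSemisimple : Set a
  IsPSemisimple = ∀ x → x ≤ 𝟏 → x ≡ 𝟏

  IsTypeIIImplicativeDerivation : (Carrier → Carrier) → Set a
  IsTypeIIImplicativeDerivation d =
    (∀ x y → d (x ⇒ y) ≡ (d x ⇒ y) ⋓₂ (x ⇒ d y)) ×
    (∀ x y → d (x ⇝ y) ≡ (d x ⇝ y) ⋓₁ (x ⇝ d y))

  IsTypeIISymmetricDerivation : (Carrier → Carrier) → Set a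
  IsTypeIISymmetricDerivation d =
    (∀ x y → d (x ⇒ y) ≡ (d x ⇒ y) ⋓₂ (d y ⇒ x)) ×
    (∀ x y → d (x ⇝ y) ≡ (d x ⇝ y) ⋓₁ (d y ⇝ x))

-- In a p-semisimple pseudo-BCI algebra the order is discrete: from x ≤ y the
-- first axiom gives (y → x) ⇝ 1 = 1, so y → x ≤ 1 and hence y → x = 1. Since
-- always x ≤ (x ⇝ y) → y and x ≤ (x → y) ⇝ y, both joins collapse to their
-- left argument, x ⋓₂ y = x = x ⋓₁ y. The second argument of the joins in the
-- two kinds of derivation is therefore irrelevant, and both conditions say
-- exactly that d(x → y) = d x → y and d(x ⇝ y) = d x ⇝ y.
module Submission where

open import Defs
open import Level using (Level)
open import Function.Bundles using (_⇔_; mk⇔)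
open import Function.Properties.Equivalence using () renaming (trans to ⇔-trans; sym to ⇔-sym)
open import Data.Product using (_×_; _,_)
open import Relation.Binary.PropositionalEquality
open ≡-Reasoning

module PseudoBCIProperties {a : Level} (A : PseudoBCI a) where
  open PseudoBCI A

  x≤x⋓₂y : ∀ x y → x ≤ (x ⋓₂ y)
  x≤x⋓₂y x y = begin
    x ⇒ ((x ⇝ y) ⇒ y)                 ≡⟨ sym (ax3 _) ⟩
    𝟏 ⇒ (x ⇒ ((x ⇝ y) ⇒ y))           ≡⟨ cong₂ (λ u v → 𝟏 ⇒ (u ⇒ ((x ⇝ y) ⇒ v))) (sym (ax4 x)) (sym (ax4 y)) ⟩
    𝟏 ⇒ ((𝟏 ⇝ x) ⇒ ((x ⇝ y) ⇒ (𝟏 ⇝ y))) ≡⟨ ax3 _ ⟩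
    (𝟏 ⇝ x) ⇒ ((x ⇝ y) ⇒ (𝟏 ⇝ y))     ≡⟨ ax2 𝟏 x y ⟩
    𝟏                                 ∎

  x⇝x⋓₁y≡𝟏 : ∀ x y → x ⇝ (x ⋓₁ y) ≡ 𝟏
  x⇝x⋓₁y≡𝟏 x y = begin
    x ⇝ ((x ⇒ y) ⇝ y)                 ≡⟨ sym (ax4 _) ⟩
    𝟏 ⇝ (x ⇝ ((x ⇒ y) ⇝ y))           ≡⟨ cong₂ (λ u v → 𝟏 ⇝ (u ⇝ ((x ⇒ y) ⇝ v))) (sym (ax3 x)) (sym (ax3 y)) ⟩
    𝟏 ⇝ ((𝟏 ⇒ x) ⇝ ((x ⇒ y) ⇝ (𝟏 ⇒ y))) ≡⟨ ax4 _ ⟩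
    (𝟏 ⇒ x) ⇝ ((x ⇒ y) ⇝ (𝟏 ⇒ y))     ≡⟨ ax1 𝟏 x y ⟩
    𝟏                                 ∎

  ⇝≡𝟏⇒≤ : ∀ {x y} → x ⇝ y ≡ 𝟏 → x ≤ y
  ⇝≡𝟏⇒≤ {x} {y} x⇝y≡𝟏 = begin
    x ⇒ y               ≡⟨ cong (x ⇒_) (sym (ax3 y)) ⟩
    x ⇒ (𝟏 ⇒ y)         ≡⟨ cong (λ u → x ⇒ (u ⇒ y)) (sym x⇝y≡𝟏) ⟩
    x ⇒ ((x ⇝ y) ⇒ y)   ≡⟨ x≤x⋓₂y x y ⟩
    𝟏                   ∎

  ≤-refl : ∀ x → x ≤ x
  ≤-refl x = begin
    x ⇒ x               ≡⟨ cong (_⇒ x) (sym (ax4 x)) ⟩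
    (𝟏 ⇝ x) ⇒ x         ≡⟨ sym (ax3 _) ⟩
    𝟏 ⇒ ((𝟏 ⇝ x) ⇒ x)   ≡⟨ x≤x⋓₂y 𝟏 x ⟩
    𝟏                   ∎

  ≤⇒reverse-≤-𝟏 : ∀ {x y} → x ≤ y → (y ⇒ x) ≤ 𝟏
  ≤⇒reverse-≤-𝟏 {x} {y} x≤y = ⇝≡𝟏⇒≤ (begin
    (y ⇒ x) ⇝ 𝟏                    ≡⟨ sym (ax4 _) ⟩
    𝟏 ⇝ ((y ⇒ x) ⇝ 𝟏)              ≡⟨ cong₂ (λ u v → u ⇝ ((y ⇒ x) ⇝ v)) (sym x≤y) (sym (≤-refl x)) ⟩
    (x ⇒ y) ⇝ ((y ⇒ x) ⇝ (x ⇒ x))  ≡⟨ ax1 x y x ⟩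
    𝟏                              ∎)

module PSemisimpleProperties {a : Level} (A : PseudoBCI a) (pss : IsPSemisimple A) where
  open PseudoBCI A
  open PseudoBCIProperties A

  ≤⇒≡ : ∀ {x y} → x ≤ y → x ≡ y
  ≤⇒≡ {x} {y} x≤y = ax5 x y x≤y (pss (y ⇒ x) (≤⇒reverse-≤-𝟏 x≤y))

  x⋓₂y≡x : ∀ x y → x ⋓₂ y ≡ x
  x⋓₂y≡x x y = sym (≤⇒≡ (x≤x⋓₂y x y))

  x⋓₁y≡x : ∀ x y → x ⋓₁ y ≡ x
  x⋓₁y≡x x y = sym (≤⇒≡ (⇝≡𝟏⇒≤ (x⇝x⋓₁y≡𝟏 x y)))

  IsPreservingResiduals : (Carrier → Carrier) → Set a
  IsPreservingResiduals d =
    (∀ x y → d (x ⇒ y) ≡ d x ⇒ y) × (∀ x y → d (x ⇝ y) ≡ d x ⇝ y)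

  symmetric⇔preservingResiduals : ∀ d →
    IsTypeIISymmetricDerivation A d ⇔ IsPreservingResiduals d
  symmetric⇔preservingResiduals d = mk⇔
    (λ (d⇒ , d⇝) → (λ x y → trans (d⇒ x y) (x⋓₂y≡x _ _))
                 , (λ x y → trans (d⇝ x y) (x⋓₁y≡x _ _)))
    (λ (d⇒ , d⇝) → (λ x y → trans (d⇒ x y) (sym (x⋓₂y≡x _ (d y ⇒ x))))
                 , (λ x y → trans (d⇝ x y) (sym (x⋓₁y≡x _ (d y ⇝ x)))))

  implicative⇔preservingResiduals : ∀ d →
    IsTypeIIImplicativeDerivation A d ⇔ IsPreservingResiduals d
  implicative⇔preservingResiduals d = mk⇔
    (λ (d⇒ , d⇝) → (λ x y → trans (d⇒ x y) (x⋓₂y≡x _ _))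
                 , (λ x y → trans (d⇝ x y) (x⋓₁y≡x _ _)))
    (λ (d⇒ , d⇝) → (λ x y → trans (d⇒ x y) (sym (x⋓₂y≡x _ (x ⇒ d y))))
                 , (λ x y → trans (d⇝ x y) (sym (x⋓₁y≡x _ (x ⇝ d y)))))

proposition5p12 : {a : Level} (A : PseudoBCI a) → IsPSemisimple A →
    (d : PseudoBCI.Carrier A → PseudoBCI.Carrier A) →
    IsTypeIISymmetricDerivation A d ⇔ IsTypeIIImplicativeDerivation A d
proposition5p12 A pss d =
  ⇔-trans (symmetric⇔preservingResiduals d) (⇔-sym (implicative⇔preservingResiduals d))
  where open PSemisimpleProperties A pss
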